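{- Let $m \in \{1,\dots,7\}$ and $G = K_{1,m}+K_{1,m}$ (the disjoint union of two copies of $K_{1,m}$). Then $G$ is equitably 2-choosable.
   Context: A list assignment $L$ for a graph $G$ assigns to each vertex $v$ a set $L(v)$ of colors; it is a $k$-assignment if $|L(v)|=k$ for all $v$. The palette of $L$ is $\bigcup_{v} L(v)$. A proper $L$-coloring is a proper coloring $f$ with $f(v)\in L(v)$ for all $v$. If $L$ is a $k$-assignment, an equitable $L$-coloring of $G$ is a proper $L$-coloring in which each color of the palette appears on at most $\lceil |V(G)|/k \rceil$ vertices. $G$ is equitably $k$-choosable if an equitable $L$-coloring exists for every $k$-assignment $L$ for $G$. -}

module Defs where

open import Data.Nat using (ℕ; zero; suc; _+_; _∸_; _≤_; NonZero)
open import Data.Nat.DivMod using (_/_)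
open import Data.Fin using (Fin; zero; suc; splitAt)
open import Data.List using (List; length; filter)
open import Data.List.Base using (allFin)
open import Data.List.Membership.Propositional using (_∈_)
open import Data.List.Relation.Unary.Unique.Propositional using (Unique)
open import Data.Sum using (_⊎_; inj₁; inj₂)
open import Data.Product using (_×_; ∃; Σ)
open import Data.Empty using (⊥)
open import Data.Unit using () renaming (⊤ to ⊤')
open import Relation.Nullary using (¬_)
open import Relation.Binary.PropositionalEquality using (_≡_; _≢_)
open import Data.Nat using (_≟_)

record Graph (n : ℕ) : Set₁ where
  field
    Adj : Fin n → Fin n → Set

open Graph public

star : (m : ℕ) → Graph (suc m)
Adj (star m) zero    zero    = ⊥
Adj (star m) zero    (suc _) = ⊤'
Adj (star m) (suc _) zero    = ⊤'
Adj (star m) (suc _) (suc _) = ⊥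

unionAdj : ∀ {a b} → Graph a → Graph b → Fin a ⊎ Fin b → Fin a ⊎ Fin b → Set
unionAdj G H (inj₁ x) (inj₁ y) = Adj G x y
unionAdj G H (inj₁ x) (inj₂ y) = ⊥
unionAdj G H (inj₂ x) (inj₁ y) = ⊥
unionAdj G H (inj₂ x) (inj₂ y) = Adj H x y

_⊕_ : ∀ {a b} → Graph a → Graph b → Graph (a + b)
Adj (_⊕_ {a} G H) i j = unionAdj G H (splitAt a i) (splitAt a j)

-- Colours are natural numbers.  A k-assignment: each L v is a list of
-- k distinct colours (i.e. a k-element set of colours).
IsKAssignment : ∀ {n} → ℕ → (Fin n → List ℕ) → Set
IsKAssignment k L = ∀ v → length (L v) ≡ k × Unique (L v)

InPalette : ∀ {n} → (Fin n → List ℕ) → ℕ → Set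
InPalette L c = ∃ λ v → c ∈ L v

IsProperLColoring : ∀ {n} → Graph n → (Fin n → List ℕ) → (Fin n → ℕ) → Set
IsProperLColoring G L f =
  (∀ u v → Adj G u v → f u ≢ f v) × (∀ v → f v ∈ L v)

colourCount : ∀ {n} → (Fin n → ℕ) → ℕ → ℕ
colourCount {n} f c = length (filter (λ v → f v ≟ c) (allFin n))

⌈_/_⌉ : ℕ → (k : ℕ) → .{{NonZero k}} → ℕ
⌈ n / k ⌉ = (n + (k ∸ 1)) / k

IsEquitableLColoring : ∀ {n} → Graph n → (k : ℕ) → .{{NonZero k}} →
                       (Fin n → List ℕ) → (Fin n → ℕ) → Set
IsEquitableLColoring {n} G k L f =
  IsProperLColoring G L f ×
  (∀ c → InPalette L c → colourCount f c ≤ ⌈ n / k ⌉)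

EquitablyChoosable : ∀ {n} → Graph n → (k : ℕ) → .{{NonZero k}} → Set
EquitablyChoosable {n} G k =
  (L : Fin n → List ℕ) → IsKAssignment k L →
  Σ (Fin n → ℕ) (λ f → IsEquitableLColoring G k L f)

-- Let L be a 2-assignment of G = K_{1,m} + K_{1,m}; G has 2m + 2 vertices,
-- so an equitable L-colouring may use each colour at most m + 1 times.
-- Fix colours s, t for the two centres.  A leaf whose list contains its
-- centre's colour is forced to the other entry; every other leaf may take
-- either entry.  A local search (module Balancing, stated for arbitrary
-- vertices with two options each) repeatedly moves a vertex off an
-- overused colour; it ends either with an equitable colouring or with a
-- colour c that is the only option of at least m + 2 vertices.  Such a c
-- is "heavy": at least m + 2 leaves have list {s , c} (first star) or
-- {t , c} (second star); the centres cannot contribute.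
-- Finally, if the centre lists are {a , b} and {a' , b'}, the four choices
-- (a , a'), (b , b'), (a , b'), (b , a') cannot all leave a heavy colour:
-- two heavy choices force their heavy colours to coincide with centre
-- colours, and the remaining configurations need 4(m + 2) ≤ 5m, i.e. m ≥ 8.
module Submission where

open import Defs
open import Data.Nat using (ℕ; zero; suc; _+_; _*_; _≤_; _<_; z≤n; s≤s; _≟_; _≤?_)
open import Data.Nat.Properties
open import Data.Nat.DivMod using (_/_; /-congˡ; +-distrib-/-∣ʳ; m*n/n≡m)
open import Data.Nat.Divisibility using (n∣m*n)
open import Data.Nat.Solver using (module +-*-Solver)
open import Data.Bool using (Bool; true; false; not; if_then_else_)
open import Data.Fin using (Fin; zero; suc; splitAt; join; punchIn; _↑ˡ_; _↑ʳ_)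
import Data.Fin.Properties as Fin
open import Data.Vec.Functional using (updateAt)
open import Data.Vec.Functional.Properties using (updateAt-updates; updateAt-minimal)
open import Data.List using (List; []; _∷_; length; filter; tabulate)
open import Data.List.Membership.Propositional using (_∈_)
open import Data.List.Relation.Unary.Any using (here; there)
open import Data.List.Relation.Unary.All using ([]; _∷_)
open import Data.List.Relation.Unary.AllPairs using (_∷_)
open import Data.List.Relation.Unary.Unique.Propositional using (Unique)
open import Data.Product using (_×_; _,_; ∃; Σ; Σ-syntax; proj₁; proj₂)
open import Data.Sum using (_⊎_; inj₁; inj₂)
open import Data.Empty using (⊥; ⊥-elim)
open import Function using (_∘_)
open import Relation.Nullary using (¬_; Dec; yes; no; contradiction)
open import Relation.Nullary.Decidable using (_×-dec_; _⊎-dec_; ¬?; decidable-stable)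
open import Relation.Binary.PropositionalEquality
open import Algebra.Properties.CommutativeMonoid.Sum +-0-commutativeMonoid
  using (sum; sum-cong-≗; sum-remove; ∑-distrib-+; sum-replicate-zero)

open +-*-Solver using (solve; _:+_; _:*_; _:=_; con)

𝟙 : {P : Set} → Dec P → ℕ
𝟙 (yes _) = 1
𝟙 (no _)  = 0

𝟙-≤1 : {P : Set} (d : Dec P) → 𝟙 d ≤ 1
𝟙-≤1 (yes _) = s≤s z≤n
𝟙-≤1 (no _)  = z≤n

𝟙-yes : {P : Set} (d : Dec P) → P → 𝟙 d ≡ 1
𝟙-yes (yes _) _ = refl
𝟙-yes (no ¬p) p = contradiction p ¬p

𝟙-no : {P : Set} (d : Dec P) → ¬ P → 𝟙 d ≡ 0
𝟙-no (yes p) ¬p = contradiction p ¬p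
𝟙-no (no _)  _  = refl

𝟙-pos : {P : Set} (d : Dec P) → 1 ≤ 𝟙 d → P
𝟙-pos (yes p) _ = p

𝟙-mono : {P Q : Set} → (P → Q) → (p : Dec P) (q : Dec Q) → 𝟙 p ≤ 𝟙 q
𝟙-mono P⇒Q (yes p) (no ¬q) = contradiction (P⇒Q p) ¬q
𝟙-mono P⇒Q (yes _) (yes _) = s≤s z≤n
𝟙-mono P⇒Q (no _)  _       = z≤n

𝟙-exclusive₂ : {P Q : Set} (p : Dec P) (q : Dec Q) → (P → Q → ⊥) → 𝟙 p + 𝟙 q ≤ 1
𝟙-exclusive₂ (yes p) (yes q) excl = ⊥-elim (excl p q)
𝟙-exclusive₂ (yes _) (no _)  _    = s≤s z≤n
𝟙-exclusive₂ (no _)  q       _    = 𝟙-≤1 q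

𝟙-exclusive₄ : {P Q R S : Set} (p : Dec P) (q : Dec Q) (r : Dec R) (s : Dec S) →
               (P → Q → ⊥) → (P → R → ⊥) → (P → S → ⊥) →
               (Q → R → ⊥) → (Q → S → ⊥) → (R → S → ⊥) →
               𝟙 p + 𝟙 q + 𝟙 r + 𝟙 s ≤ 1
𝟙-exclusive₄ (yes p) (yes q) _       _       pq _  _  _  _  _  = ⊥-elim (pq p q)
𝟙-exclusive₄ (yes p) (no _)  (yes r) _       _  pr _  _  _  _  = ⊥-elim (pr p r)
𝟙-exclusive₄ (yes p) (no _)  (no _)  (yes s) _  _  ps _  _  _  = ⊥-elim (ps p s)
𝟙-exclusive₄ (yes _) (no _)  (no _)  (no _)  _  _  _  _  _  _  = s≤s z≤n
𝟙-exclusive₄ (no _)  (yes q) (yes r) _       _  _  _  qr _  _  = ⊥-elim (qr q r)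
𝟙-exclusive₄ (no _)  (yes q) (no _)  (yes s) _  _  _  _  qs _  = ⊥-elim (qs q s)
𝟙-exclusive₄ (no _)  (yes _) (no _)  (no _)  _  _  _  _  _  _  = s≤s z≤n
𝟙-exclusive₄ (no _)  (no _)  r       s       _  _  _  _  _  rs = 𝟙-exclusive₂ r s rs

sum-mono : ∀ {n} {g h : Fin n → ℕ} → (∀ i → g i ≤ h i) → sum g ≤ sum h
sum-mono {zero}  _   = z≤n
sum-mono {suc n} g≤h = +-mono-≤ (g≤h zero) (sum-mono (g≤h ∘ suc))

sum-≤-card : ∀ {n} (h : Fin n → ℕ) → (∀ i → h i ≤ 1) → sum h ≤ n
sum-≤-card {zero}  h h≤1 = z≤n
sum-≤-card {suc n} h h≤1 = +-mono-≤ (h≤1 zero) (sum-≤-card (h ∘ suc) (h≤1 ∘ suc))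

sum-pos : ∀ {n} (h : Fin n → ℕ) → 1 ≤ sum h → ∃ λ i → 1 ≤ h i
sum-pos {suc n} h pos with h zero in eq
... | suc _ = zero , subst (1 ≤_) (sym eq) (s≤s z≤n)
... | zero  with sum-pos (h ∘ suc) pos
...   | i , h-pos = suc i , h-pos

sum-update : ∀ {n} {h h' : Fin n → ℕ} (v : Fin n) →
             (∀ w → w ≢ v → h' w ≡ h w) → sum h' + h v ≡ sum h + h' v
sum-update {suc n} {h} {h'} v agree = begin
  sum h' + h v                 ≡⟨ cong (_+ h v) (sum-remove {i = v} h') ⟩
  (h' v + rest h') + h v       ≡⟨ cong (λ r → (h' v + r) + h v) same-rest ⟩
  (h' v + rest h) + h v        ≡⟨ solve 3 (λ x r y → (x :+ r) :+ y := (y :+ r) :+ x)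
                                    refl (h' v) (rest h) (h v) ⟩
  (h v + rest h) + h' v        ≡⟨ cong (_+ h' v) (sym (sum-remove {i = v} h)) ⟩
  sum h + h' v                 ∎
  where
  open ≡-Reasoning
  rest : (Fin (suc n) → ℕ) → ℕ
  rest g = sum (λ w → g (punchIn v w))
  same-rest : rest h' ≡ rest h
  same-rest = sum-cong-≗ (λ w → agree (punchIn v w) (Fin.punchInᵢ≢i v w))

sum-split : ∀ a {b} (h : Fin (a + b) → ℕ) →
            sum h ≡ sum (λ i → h (i ↑ˡ b)) + sum (λ i → h (a ↑ʳ i))
sum-split zero    h = refl
sum-split (suc a) h = trans (cong (h zero +_) (sum-split a (h ∘ suc))) (sym (+-assoc (h zero) _ _))

occurrences : ∀ {N} → (Fin N → ℕ) → ℕ → ℕ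
occurrences f e = sum (λ v → 𝟙 (f v ≟ e))

length-filter-∷ : ∀ {A : Set} {P : A → Set} (P? : ∀ x → Dec (P x)) x xs →
                  length (filter P? (x ∷ xs)) ≡ 𝟙 (P? x) + length (filter P? xs)
length-filter-∷ P? x xs with P? x
... | yes _ = refl
... | no _  = refl

length-filter-tabulate : ∀ {A : Set} {n} (f : A → ℕ) e (g : Fin n → A) →
  length (filter (λ x → f x ≟ e) (tabulate g)) ≡ sum (λ i → 𝟙 (f (g i) ≟ e))
length-filter-tabulate {n = zero}  f e g = refl
length-filter-tabulate {n = suc n} f e g =
  trans (length-filter-∷ (λ x → f x ≟ e) (g zero) _)
        (cong (𝟙 (f (g zero) ≟ e) +_) (length-filter-tabulate f e (g ∘ suc)))

colourCount≡occurrences : ∀ {N} (f : Fin N → ℕ) e → colourCount f e ≡ occurrences f e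
colourCount≡occurrences f e = length-filter-tabulate f e (λ v → v)

occurrences-pair : ∀ {N} (f : Fin N → ℕ) {c e} → c ≢ e →
                   occurrences f c + occurrences f e ≤ N
occurrences-pair f {c} {e} c≢e =
  subst (_≤ _) (∑-distrib-+ (λ v → 𝟙 (f v ≟ c)) (λ v → 𝟙 (f v ≟ e)))
    (sum-≤-card _ (λ v → 𝟙-exclusive₂ (f v ≟ c) (f v ≟ e) (λ fv≡c fv≡e → c≢e (trans (sym fv≡c) fv≡e))))

occurrences-pos : ∀ {N} (f : Fin N → ℕ) {e} → 1 ≤ occurrences f e → ∃ λ v → f v ≡ e
occurrences-pos f {e} pos with sum-pos _ pos
... | v , ind-pos = v , 𝟙-pos (f v ≟ e) ind-pos

occurrences-update : ∀ {N} {f f' : Fin N → ℕ} (v : Fin N) → (∀ w → w ≢ v → f' w ≡ f w) →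
  ∀ e → occurrences f' e + 𝟙 (f v ≟ e) ≡ occurrences f e + 𝟙 (f' v ≟ e)
occurrences-update v agree e = sum-update v (λ w w≢v → cong (λ x → 𝟙 (x ≟ e)) (agree w w≢v))

-- Every vertex v of Fin N has two options, option v true and option v
-- false; a choice β : Fin N → Bool colours v with option v (β v).  When
-- N ≤ 2B, either some choice uses every colour at most B times, or some
-- colour c is the only option of more than B vertices.

module Balancing {N : ℕ} (option : Fin N → Bool → ℕ) (B : ℕ) (N≤2B : N ≤ B + B) where

  colouring : (Fin N → Bool) → Fin N → ℕ
  colouring β v = option v (β v)

  count : (Fin N → Bool) → ℕ → ℕ
  count β = occurrences (colouring β)

  Balanced : (Fin N → Bool) → Set
  Balanced β = ∀ e → count β e ≤ B

  Stuck : ℕ → Fin N → Set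
  Stuck c v = option v true ≡ c × option v false ≡ c

  stuck? : ∀ c v → Dec (Stuck c v)
  stuck? c v = (option v true ≟ c) ×-dec (option v false ≟ c)

  stuckCount : ℕ → ℕ
  stuckCount c = sum (λ v → 𝟙 (stuck? c v))

  Outcome : Set
  Outcome = (Σ[ β ∈ (Fin N → Bool) ] Balanced β) ⊎ (∃ λ c → B < stuckCount c)

  overuse-unique : ∀ β {c e} → B < count β c → e ≢ c → suc (count β e) ≤ B
  overuse-unique β {c} {e} over e≢c = +-cancelˡ-≤ B _ _ (begin
    B + suc (count β e)     ≡⟨ +-suc B _ ⟩
    suc B + count β e       ≤⟨ +-monoˡ-≤ _ over ⟩
    count β c + count β e   ≤⟨ occurrences-pair (colouring β) (≢-sym e≢c) ⟩
    N                       ≤⟨ N≤2B ⟩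
    B + B                   ∎)
    where open ≤-Reasoning

  -- Either β is balanced or some colour is overused; only the colours of
  -- the N vertices need to be checked.
  overused-or-balanced : ∀ β → Balanced β ⊎ ∃ λ c → B < count β c
  overused-or-balanced β with Fin.all? (λ v → count β (colouring β v) ≤? B)
  ... | yes fine = inj₁ balanced
    where
    balanced : Balanced β
    balanced e with count β e ≤? B
    ... | yes e≤B = e≤B
    ... | no e≰B with occurrences-pos (colouring β) (≤-trans (s≤s z≤n) (≰⇒> e≰B))
    ...   | v , refl = contradiction (fine v) e≰B
  ... | no ¬fine with Fin.¬∀⟶∃¬ N _ (λ v → count β (colouring β v) ≤? B) ¬fine
  ...   | v , v≰B = inj₂ (colouring β v , ≰⇒> v≰B)

  settled : ∀ β {c} → count β c ≤ B → (∀ e → e ≢ c → count β e ≤ B) → Balanced β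
  settled β {c} c≤B rest e with e ≟ c
  ... | yes refl = c≤B
  ... | no e≢c   = rest e e≢c

  flipAt : (Fin N → Bool) → Fin N → Fin N → Bool
  flipAt β v = updateAt β v not

  flip-balance : ∀ β v e → count (flipAt β v) e + 𝟙 (colouring β v ≟ e)
                         ≡ count β e + 𝟙 (option v (not (β v)) ≟ e)
  flip-balance β v e = begin
    count (flipAt β v) e + 𝟙 (colouring β v ≟ e)
      ≡⟨ occurrences-update v (λ w w≢v → cong (option w) (updateAt-minimal w v β w≢v)) e ⟩
    count β e + 𝟙 (option v (flipAt β v v) ≟ e)
      ≡⟨ cong (λ b → count β e + 𝟙 (option v b ≟ e)) (updateAt-updates v β) ⟩
    count β e + 𝟙 (option v (not (β v)) ≟ e) ∎
    where open ≡-Reasoning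

  flip-decreases : ∀ β v {c} → colouring β v ≡ c → option v (not (β v)) ≢ c →
                   suc (count (flipAt β v) c) ≡ count β c
  flip-decreases β v {c} v↦c other≢c = begin
    suc (count (flipAt β v) c)                    ≡⟨ +-comm 1 _ ⟩
    count (flipAt β v) c + 1                      ≡⟨ cong (count (flipAt β v) c +_) (sym (𝟙-yes (colouring β v ≟ c) v↦c)) ⟩
    count (flipAt β v) c + 𝟙 (colouring β v ≟ c)  ≡⟨ flip-balance β v c ⟩
    count β c + 𝟙 (option v (not (β v)) ≟ c)      ≡⟨ cong (count β c +_) (𝟙-no (option v (not (β v)) ≟ c) other≢c) ⟩
    count β c + 0                                 ≡⟨ +-identityʳ _ ⟩
    count β c                                     ∎
    where open ≡-Reasoning

  flip-increases-by-one : ∀ β v e → count (flipAt β v) e ≤ suc (count β e)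
  flip-increases-by-one β v e = begin
    count (flipAt β v) e                          ≤⟨ m≤m+n _ _ ⟩
    count (flipAt β v) e + 𝟙 (colouring β v ≟ e)  ≡⟨ flip-balance β v e ⟩
    count β e + 𝟙 (option v (not (β v)) ≟ e)      ≤⟨ +-monoʳ-≤ _ (𝟙-≤1 _) ⟩
    count β e + 1                                 ≡⟨ +-comm _ 1 ⟩
    suc (count β e)                               ∎
    where open ≤-Reasoning

  count≤stuckCount : ∀ β {c} → (∀ v → colouring β v ≡ c → option v (not (β v)) ≡ c) →
                     count β c ≤ stuckCount c
  count≤stuckCount β {c} unmovable =
    sum-mono (λ v → 𝟙-mono (λ v↦c → stuck (β v) v↦c (unmovable v v↦c))
                           (colouring β v ≟ c) (stuck? c v))
    where
    stuck : ∀ {v} b → option v b ≡ c → option v (not b) ≡ c → Stuck c v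
    stuck true  e e' = e  , e'
    stuck false e e' = e' , e

  -- Repairing an overused colour c while all other colours stay within B;
  -- k bounds count β c and decreases with every flip.
  repair : ∀ k β c → count β c ≤ k → (∀ e → e ≢ c → count β e ≤ B) → Outcome
  repair zero    β c c≤0 rest = inj₁ (β , settled β (≤-trans c≤0 z≤n) rest)
  repair (suc k) β c c≤k rest with count β c ≤? B
  ... | yes c≤B = inj₁ (β , settled β c≤B rest)
  ... | no c≰B with Fin.any? (λ v → (colouring β v ≟ c) ×-dec ¬? (option v (not (β v)) ≟ c))
  ...   | yes (v , v↦c , other≢c) =
          repair k (flipAt β v) c
            (≤-pred (subst (_≤ suc k) (sym (flip-decreases β v v↦c other≢c)) c≤k))
            (λ e e≢c → ≤-trans (flip-increases-by-one β v e) (overuse-unique β (≰⇒> c≰B) e≢c))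
  ...   | no none = inj₂ (c , ≤-trans (≰⇒> c≰B) (count≤stuckCount β unmovable))
    where
    unmovable : ∀ v → colouring β v ≡ c → option v (not (β v)) ≡ c
    unmovable v v↦c = decidable-stable (option v (not (β v)) ≟ c) (λ ne → none (v , v↦c , ne))

  balance : Outcome
  balance with overused-or-balanced (λ _ → false)
  ... | inj₁ bal = inj₁ (_ , bal)
  ... | inj₂ (c , over) =
        repair _ _ c ≤-refl (λ e e≢c → ≤-trans (n≤1+n _) (overuse-unique _ over e≢c))

SamePair : ℕ → ℕ → ℕ → ℕ → Set
SamePair x y x' y' = (x ≡ x' × y ≡ y') ⊎ (x ≡ y' × y ≡ x')

samePair? : ∀ x y x' y' → Dec (SamePair x y x' y')
samePair? x y x' y' = ((x ≟ x') ×-dec (y ≟ y')) ⊎-dec ((x ≟ y') ×-dec (y ≟ x'))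

samePair-common : ∀ {x y x' y' p q} → SamePair x y p q → SamePair x' y' p q → SamePair x y x' y'
samePair-common (inj₁ (xp , yq)) (inj₁ (x'p , y'q)) = inj₁ (trans xp (sym x'p) , trans yq (sym y'q))
samePair-common (inj₁ (xp , yq)) (inj₂ (x'q , y'p)) = inj₂ (trans xp (sym y'p) , trans yq (sym x'q))
samePair-common (inj₂ (xq , yp)) (inj₁ (x'p , y'q)) = inj₂ (trans xq (sym y'q) , trans yp (sym x'p))
samePair-common (inj₂ (xq , yp)) (inj₂ (x'q , y'p)) = inj₁ (trans xq (sym x'q) , trans yp (sym y'p))

samePair-diagonal : ∀ {x p q} → SamePair x x p q → p ≡ q
samePair-diagonal (inj₁ (xp , xq)) = trans (sym xp) xq
samePair-diagonal (inj₂ (xq , xp)) = trans (sym xp) xq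

different-pair : ∀ {x y x' y'} → x ≢ x' → x ≢ y' → ¬ SamePair x y x' y'
different-pair x≢x' _ (inj₁ (xx' , _)) = x≢x' xx'
different-pair _ x≢y' (inj₂ (xy' , _)) = x≢y' xy'

different-pair' : ∀ {x y x' y'} → y ≢ y' → y ≢ x' → ¬ SamePair x y x' y'
different-pair' y≢y' _ (inj₁ (_ , yy')) = y≢y' yy'
different-pair' _ y≢x' (inj₂ (_ , yx')) = y≢x' yx'

-- Leaf j of a star with m leaves has the list {first j , second j}.
record LeafLists (m : ℕ) : Set where
  field
    first second : Fin m → ℕ
    distinct     : ∀ j → first j ≢ second j
open LeafLists

hasList? : ∀ {m} (ℓ : LeafLists m) x y j → Dec (SamePair x y (first ℓ j) (second ℓ j))
hasList? ℓ x y j = samePair? x y (first ℓ j) (second ℓ j)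

hasList : ∀ {m} → LeafLists m → ℕ → ℕ → Fin m → ℕ
hasList ℓ x y j = 𝟙 (hasList? ℓ x y j)

pairCount : ∀ {m} → LeafLists m → ℕ → ℕ → ℕ
pairCount ℓ x y = sum (hasList ℓ x y)

-- Each leaf has one list, so counts of different pairs add up to at most m.
pairCount-≤ : ∀ {m} (ℓ : LeafLists m) x y → pairCount ℓ x y ≤ m
pairCount-≤ ℓ x y = sum-≤-card _ (λ j → 𝟙-≤1 _)

pairCount-diagonal : ∀ {m} (ℓ : LeafLists m) x → pairCount ℓ x x ≡ 0
pairCount-diagonal {m} ℓ x =
  trans (sum-cong-≗ (λ j → 𝟙-no _ (distinct ℓ j ∘ samePair-diagonal))) (sum-replicate-zero m)

lists-exclusive : ∀ {x y x' y' p q} → ¬ SamePair x y x' y' → SamePair x y p q → SamePair x' y' p q → ⊥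
lists-exclusive d s s' = d (samePair-common s s')

pairCount-disjoint₂ : ∀ {m} (ℓ : LeafLists m) {x₁ y₁ x₂ y₂} → ¬ SamePair x₁ y₁ x₂ y₂ →
                      pairCount ℓ x₁ y₁ + pairCount ℓ x₂ y₂ ≤ m
pairCount-disjoint₂ {m} ℓ {x₁} {y₁} {x₂} {y₂} d =
  subst (_≤ m) (∑-distrib-+ (hasList ℓ x₁ y₁) (hasList ℓ x₂ y₂))
    (sum-≤-card _ (λ j → 𝟙-exclusive₂ (hasList? ℓ x₁ y₁ j) (hasList? ℓ x₂ y₂ j) (lists-exclusive d)))

pairCount-disjoint₄ : ∀ {m} (ℓ : LeafLists m) {x₁ y₁ x₂ y₂ x₃ y₃ x₄ y₄} →
  ¬ SamePair x₁ y₁ x₂ y₂ → ¬ SamePair x₁ y₁ x₃ y₃ → ¬ SamePair x₁ y₁ x₄ y₄ →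
  ¬ SamePair x₂ y₂ x₃ y₃ → ¬ SamePair x₂ y₂ x₄ y₄ → ¬ SamePair x₃ y₃ x₄ y₄ →
  pairCount ℓ x₁ y₁ + pairCount ℓ x₂ y₂ + pairCount ℓ x₃ y₃ + pairCount ℓ x₄ y₄ ≤ m
pairCount-disjoint₄ {m} ℓ {x₁} {y₁} {x₂} {y₂} {x₃} {y₃} {x₄} {y₄} d₁₂ d₁₃ d₁₄ d₂₃ d₂₄ d₃₄ =
  subst (_≤ m) split
    (sum-≤-card _ (λ j → 𝟙-exclusive₄ (hasList? ℓ x₁ y₁ j) (hasList? ℓ x₂ y₂ j) (hasList? ℓ x₃ y₃ j) (hasList? ℓ x₄ y₄ j)
      (lists-exclusive d₁₂) (lists-exclusive d₁₃) (lists-exclusive d₁₄)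
      (lists-exclusive d₂₃) (lists-exclusive d₂₄) (lists-exclusive d₃₄)))
  where
  h₁ h₂ h₃ h₄ : Fin m → ℕ
  h₁ = hasList ℓ x₁ y₁
  h₂ = hasList ℓ x₂ y₂
  h₃ = hasList ℓ x₃ y₃
  h₄ = hasList ℓ x₄ y₄
  split : sum (λ j → h₁ j + h₂ j + h₃ j + h₄ j) ≡ sum h₁ + sum h₂ + sum h₃ + sum h₄
  split = trans (∑-distrib-+ _ h₄)
            (cong (_+ sum h₄) (trans (∑-distrib-+ _ h₃) (cong (_+ sum h₃) (∑-distrib-+ h₁ h₂))))

no-two-excesses : ∀ {m} A B C D → A + B ≤ m → C + D ≤ m →
                  suc (suc m) ≤ A + C → suc (suc m) ≤ B + D → ⊥
no-two-excesses {m} A B C D A+B≤m C+D≤m A+C≥ B+D≥ =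
  contradiction (+-cancelˡ-≤ (m + m) 4 0 total) λ ()
  where
  open ≤-Reasoning
  total : (m + m) + 4 ≤ (m + m) + 0
  total = begin
    (m + m) + 4                ≡⟨ solve 1 (λ m → (m :+ m) :+ con 4 := (con 2 :+ m) :+ (con 2 :+ m)) refl m ⟩
    suc (suc m) + suc (suc m)  ≤⟨ +-mono-≤ A+C≥ B+D≥ ⟩
    (A + C) + (B + D)          ≡⟨ solve 4 (λ a b c d → (a :+ c) :+ (b :+ d) := (a :+ b) :+ (c :+ d)) refl A B C D ⟩
    (A + B) + (C + D)          ≤⟨ +-mono-≤ A+B≤m C+D≤m ⟩
    m + m                      ≡⟨ +-identityʳ (m + m) ⟨
    (m + m) + 0                ∎

-- Four sums X + u₁, Y + u₂, X + u₃, Y + u₄ with X, Y ≤ m and u₁ + u₂ + u₃ + u₄ ≤ m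
-- cannot all exceed m + 1 unless 4(m + 2) ≤ 5m, i.e. m ≥ 8.
no-four-excesses : ∀ {m} X Y u₁ u₂ u₃ u₄ → m ≤ 7 → X ≤ m → Y ≤ m → u₁ + u₂ + u₃ + u₄ ≤ m →
                   suc (suc m) ≤ X + u₁ → suc (suc m) ≤ Y + u₂ →
                   suc (suc m) ≤ X + u₃ → suc (suc m) ≤ Y + u₄ → ⊥
no-four-excesses {m} X Y u₁ u₂ u₃ u₄ m≤7 X≤m Y≤m u≤m e₁ e₂ e₃ e₄ =
  contradiction (+-cancelˡ-≤ (m + m + m + m) 8 m total) (<⇒≱ (s≤s m≤7))
  where
  open ≤-Reasoning
  K : ℕ
  K = suc (suc m)
  total : (m + m + m + m) + 8 ≤ (m + m + m + m) + m
  total = begin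
    (m + m + m + m) + 8                    ≡⟨ solve 1 (λ m → (m :+ m :+ m :+ m) :+ con 8
                                                 := (con 2 :+ m) :+ (con 2 :+ m) :+ (con 2 :+ m) :+ (con 2 :+ m)) refl m ⟩
    K + K + K + K                          ≤⟨ +-mono-≤ (+-mono-≤ (+-mono-≤ e₁ e₂) e₃) e₄ ⟩
    (X + u₁) + (Y + u₂) + (X + u₃) + (Y + u₄) ≡⟨ solve 6 (λ x y a b c d → (x :+ a) :+ (y :+ b) :+ (x :+ c) :+ (y :+ d)
                                                 := (x :+ x :+ y :+ y) :+ (a :+ b :+ c :+ d)) refl X Y u₁ u₂ u₃ u₄ ⟩
    (X + X + Y + Y) + (u₁ + u₂ + u₃ + u₄)  ≤⟨ +-mono-≤ (+-mono-≤ (+-mono-≤ (+-mono-≤ X≤m X≤m) Y≤m) Y≤m) u≤m ⟩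
    (m + m + m + m) + m                    ∎

-- Two stars with m leaves each, leaf lists ℓ₁ and ℓ₂, centres coloured s
-- and t.  A colour c is heavy when at least m + 2 leaves are forced to c,
-- i.e. have list {s , c} in the first star or {t , c} in the second.

module Heaviness {m : ℕ} (ℓ₁ ℓ₂ : LeafLists m) where
  open ≤-Reasoning

  Heavy : ℕ → ℕ → ℕ → Set
  Heavy s t c = suc (suc m) ≤ pairCount ℓ₁ s c + pairCount ℓ₂ t c

  overfull : ∀ {X} → suc (suc m) ≤ X → X ≤ suc m → ⊥
  overfull m+2≤X X≤m+1 = 1+n≰n (≤-trans m+2≤X X≤m+1)

  heavy-avoids-centres : ∀ {s t c} → Heavy s t c → c ≢ s × c ≢ t
  heavy-avoids-centres {s} {t} h =
      (λ { refl → overfull h (begin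
           pairCount ℓ₁ s s + pairCount ℓ₂ t s ≡⟨ cong (_+ pairCount ℓ₂ t s) (pairCount-diagonal ℓ₁ s) ⟩
           pairCount ℓ₂ t s                    ≤⟨ m≤n⇒m≤1+n (pairCount-≤ ℓ₂ t s) ⟩
           suc m                               ∎) })
    , (λ { refl → overfull h (begin
           pairCount ℓ₁ s t + pairCount ℓ₂ t t ≡⟨ cong (pairCount ℓ₁ s t +_) (pairCount-diagonal ℓ₂ t) ⟩
           pairCount ℓ₁ s t + 0                ≤⟨ m≤n⇒m≤1+n (subst (_≤ m) (sym (+-identityʳ _)) (pairCount-≤ ℓ₁ s t)) ⟩
           suc m                               ∎) })

  -- A colour that is the only option of m + 2 vertices (a centre or a forced
  -- leaf) is heavy: since m ≥ 1, the centres cannot be among them.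
  heavy-from-stuck : ∀ {s t c} → 1 ≤ m →
    suc (suc m) ≤ (𝟙 (s ≟ c) + pairCount ℓ₁ s c) + (𝟙 (t ≟ c) + pairCount ℓ₂ t c) → Heavy s t c
  heavy-from-stuck {s} {t} {c} 1≤m h with s ≟ c | t ≟ c
  ... | no _     | no _     = h
  ... | yes refl | yes refl = ⊥-elim (overfull h (begin
        suc (pairCount ℓ₁ s s) + suc (pairCount ℓ₂ s s)
          ≡⟨ cong₂ (λ x y → suc x + suc y) (pairCount-diagonal ℓ₁ s) (pairCount-diagonal ℓ₂ s) ⟩
        2 ≤⟨ s≤s 1≤m ⟩
        suc m ∎))
  ... | yes refl | no _     = ⊥-elim (overfull h (begin
        suc (pairCount ℓ₁ s s) + pairCount ℓ₂ t s ≡⟨ cong (λ x → suc x + pairCount ℓ₂ t s) (pairCount-diagonal ℓ₁ s) ⟩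
        suc (pairCount ℓ₂ t s)                    ≤⟨ s≤s (pairCount-≤ ℓ₂ t s) ⟩
        suc m ∎))
  ... | no _     | yes refl = ⊥-elim (overfull h (begin
        pairCount ℓ₁ s t + suc (pairCount ℓ₂ t t) ≡⟨ cong (λ x → pairCount ℓ₁ s t + suc x) (pairCount-diagonal ℓ₂ t) ⟩
        pairCount ℓ₁ s t + 1                      ≡⟨ +-comm _ 1 ⟩
        suc (pairCount ℓ₁ s t)                    ≤⟨ s≤s (pairCount-≤ ℓ₁ s t) ⟩
        suc m ∎))

  two-heavy : ∀ {s t c s' t' c'} → ¬ SamePair s c s' c' → ¬ SamePair t c t' c' →
              Heavy s t c → Heavy s' t' c' → ⊥
  two-heavy {s} {t} {c} {s'} {t'} {c'} d₁ d₂ =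
    no-two-excesses (pairCount ℓ₁ s c) (pairCount ℓ₁ s' c') (pairCount ℓ₂ t c) (pairCount ℓ₂ t' c')
      (pairCount-disjoint₂ ℓ₁ d₁) (pairCount-disjoint₂ ℓ₂ d₂)

  heavy-match : ∀ {s t x s' t' y} → s ≢ s' → t ≢ t' → Heavy s t x → Heavy s' t' y →
                (x ≡ s' × y ≡ s) ⊎ (x ≡ t' × y ≡ t)
  heavy-match {s} {t} {x} {s'} {t'} {y} s≢s' t≢t' h h'
    with samePair? s x s' y | samePair? t x t' y
  ... | yes (inj₁ (s≡s' , _))   | _                       = contradiction s≡s' s≢s'
  ... | yes (inj₂ (s≡y , x≡s')) | _                       = inj₁ (x≡s' , sym s≡y)
  ... | no _                    | yes (inj₁ (t≡t' , _))   = contradiction t≡t' t≢t'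
  ... | no _                    | yes (inj₂ (t≡y , x≡t')) = inj₂ (x≡t' , sym t≡y)
  ... | no d₁                   | no d₂                   = ⊥-elim (two-heavy d₁ d₂ h h')

  -- The configuration where the first star's centre colours are heavy for
  -- each other: the four heavy sums need 4(m + 2) ≤ 5m.
  four-heavy : ∀ {a b a' b'} → m ≤ 7 → a ≢ b → a' ≢ b' →
               Heavy a a' b → Heavy b b' a → Heavy a b' b → Heavy b a' a → ⊥
  four-heavy {a} {b} {a'} {b'} m≤7 a≢b a'≢b' h₁ h₂ h₃ h₄ =
    no-four-excesses (pairCount ℓ₁ a b) (pairCount ℓ₁ b a)
      (pairCount ℓ₂ a' b) (pairCount ℓ₂ b' a) (pairCount ℓ₂ b' b) (pairCount ℓ₂ a' a)
      m≤7 (pairCount-≤ ℓ₁ a b) (pairCount-≤ ℓ₁ b a)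
      (pairCount-disjoint₄ ℓ₂
        (different-pair a'≢b' (≢-sym a≢a')) (different-pair a'≢b' (≢-sym b≢a'))
        (different-pair' (≢-sym a≢b) b≢a')  (different-pair' a≢b a≢b')
        (different-pair (≢-sym a'≢b') (≢-sym a≢b')) (different-pair (≢-sym a'≢b') (≢-sym a≢b')))
      h₁ h₂ h₃ h₄
    where
    b≢a' : b ≢ a'
    b≢a' = proj₂ (heavy-avoids-centres h₁)
    a≢b' : a ≢ b'
    a≢b' = proj₂ (heavy-avoids-centres h₂)
    a≢a' : a ≢ a'
    a≢a' = proj₂ (heavy-avoids-centres h₄)

module _ {m : ℕ} (ℓ₁ ℓ₂ : LeafLists m) where
  open Heaviness ℓ₁ ℓ₂

  heavy-swap : ∀ {s t c} → Heavy s t c → Heaviness.Heavy ℓ₂ ℓ₁ t s c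
  heavy-swap {s} {t} {c} = subst (suc (suc m) ≤_) (+-comm (pairCount ℓ₁ s c) (pairCount ℓ₂ t c))

  not-all-heavy : m ≤ 7 → ∀ {a b a' b' c₁ c₂ c₃ c₄} → a ≢ b → a' ≢ b' →
                  Heavy a a' c₁ → Heavy b b' c₂ → Heavy a b' c₃ → Heavy b a' c₄ → ⊥
  not-all-heavy m≤7 a≢b a'≢b' h₁ h₂ h₃ h₄
    with heavy-match a≢b a'≢b' h₁ h₂ | heavy-match a≢b (≢-sym a'≢b') h₃ h₄
  ... | inj₁ (refl , refl) | inj₁ (refl , refl) = four-heavy m≤7 a≢b a'≢b' h₁ h₂ h₃ h₄
  ... | inj₁ (refl , refl) | inj₂ (refl , refl) =
        two-heavy (different-pair' (proj₂ (heavy-avoids-centres h₁)) (≢-sym a≢b))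
                  (different-pair' (proj₂ (heavy-avoids-centres h₁)) (≢-sym (proj₁ (heavy-avoids-centres h₄))))
                  h₁ h₃
  ... | inj₂ (refl , refl) | inj₁ (refl , refl) =
        two-heavy (different-pair' (≢-sym (proj₂ (heavy-avoids-centres h₃))) (proj₁ (heavy-avoids-centres h₁)))
                  (different-pair a'≢b' (proj₁ (heavy-avoids-centres h₂)))
                  h₁ h₃
  ... | inj₂ (refl , refl) | inj₂ (refl , refl) =
        Heaviness.four-heavy ℓ₂ ℓ₁ m≤7 a'≢b' a≢b (heavy-swap h₁) (heavy-swap h₂) (heavy-swap h₄) (heavy-swap h₃)

first-success : ∀ {A B₁ B₂ B₃ B₄ : Set} → A ⊎ B₁ → A ⊎ B₂ → A ⊎ B₃ → A ⊎ B₄ →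
                (B₁ → B₂ → B₃ → B₄ → ⊥) → A
first-success (inj₁ x) _        _        _        _    = x
first-success (inj₂ _) (inj₁ x) _        _        _    = x
first-success (inj₂ _) (inj₂ _) (inj₁ x) _        _    = x
first-success (inj₂ _) (inj₂ _) (inj₂ _) (inj₁ x) _    = x
first-success (inj₂ f₁) (inj₂ f₂) (inj₂ f₃) (inj₂ f₄) fail = ⊥-elim (fail f₁ f₂ f₃ f₄)

leafColour : ℕ → ℕ → ℕ → Bool → ℕ
leafColour z p q b with p ≟ z | q ≟ z
... | yes _ | _     = q
... | no _  | yes _ = p
... | no _  | no _  = if b then q else p

leafColour-avoids : ∀ z p q b → p ≢ q → leafColour z p q b ≢ z
leafColour-avoids z p q b p≢q with p ≟ z | q ≟ z
... | yes p≡z | _     = λ q≡z → p≢q (trans p≡z (sym q≡z))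
... | no p≢z  | yes _ = p≢z
leafColour-avoids z p q true  p≢q | no _   | no q≢z = q≢z
leafColour-avoids z p q false p≢q | no p≢z | no _   = p≢z

leafColour-on-list : ∀ z p q b → leafColour z p q b ≡ p ⊎ leafColour z p q b ≡ q
leafColour-on-list z p q b with p ≟ z | q ≟ z
... | yes _ | _     = inj₂ refl
... | no _  | yes _ = inj₁ refl
leafColour-on-list z p q true  | no _ | no _ = inj₂ refl
leafColour-on-list z p q false | no _ | no _ = inj₁ refl

leafColour-stuck : ∀ z p q {c} → p ≢ q → leafColour z p q true ≡ c → leafColour z p q false ≡ c →
                   SamePair z c p q
leafColour-stuck z p q p≢q on-true on-false with p ≟ z | q ≟ z
... | yes p≡z | _       = inj₁ (sym p≡z , sym on-true)
... | no _    | yes q≡z = inj₂ (sym q≡z , sym on-true)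
... | no _    | no _    = ⊥-elim (p≢q (trans on-false (sym on-true)))

starOption : ∀ {m} → ℕ → LeafLists m → Fin (suc m) → Bool → ℕ
starOption s ℓ zero    _ = s
starOption s ℓ (suc j) b = leafColour s (first ℓ j) (second ℓ j) b

starOption-proper : ∀ {m} s (ℓ : LeafLists m) i j b b' → Adj (star m) i j →
                    starOption s ℓ i b ≢ starOption s ℓ j b'
starOption-proper s ℓ zero    (suc j) b b' _ = ≢-sym (leafColour-avoids s _ _ b' (distinct ℓ j))
starOption-proper s ℓ (suc i) zero    b b' _ = leafColour-avoids s _ _ b (distinct ℓ i)

starOption-∈ : ∀ {m} s (ℓ : LeafLists m) (M : Fin (suc m) → List ℕ) → s ∈ M zero →
               (∀ j → first ℓ j ∈ M (suc j)) → (∀ j → second ℓ j ∈ M (suc j)) →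
               ∀ i b → starOption s ℓ i b ∈ M i
starOption-∈ s ℓ M s∈ first∈ second∈ zero    b = s∈
starOption-∈ s ℓ M s∈ first∈ second∈ (suc j) b with leafColour-on-list s (first ℓ j) (second ℓ j) b
... | inj₁ e = subst (_∈ M (suc j)) (sym e) (first∈ j)
... | inj₂ e = subst (_∈ M (suc j)) (sym e) (second∈ j)

StarForced : ∀ {m} → ℕ → LeafLists m → ℕ → Fin (suc m) → Set
StarForced s ℓ c zero    = s ≡ c
StarForced s ℓ c (suc j) = SamePair s c (first ℓ j) (second ℓ j)

-- Forcedness is decidable; summed over the star it is 𝟙 (s ≟ c) + pairCount ℓ s c.
starForced? : ∀ {m} s (ℓ : LeafLists m) c i → Dec (StarForced s ℓ c i)
starForced? s ℓ c zero    = s ≟ c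
starForced? s ℓ c (suc j) = hasList? ℓ s c j

starOption-stuck : ∀ {m} s (ℓ : LeafLists m) {c} i →
                   starOption s ℓ i true ≡ c → starOption s ℓ i false ≡ c → StarForced s ℓ c i
starOption-stuck s ℓ zero    s≡c _ = s≡c
starOption-stuck s ℓ (suc j)       = leafColour-stuck s _ _ (distinct ℓ j)

entry₁ entry₂ : List ℕ → ℕ
entry₁ (x ∷ _)     = x
entry₁ []          = 0
entry₂ (_ ∷ y ∷ _) = y
entry₂ _           = 0

entry₁-∈ : ∀ {xs} → length xs ≡ 2 → entry₁ xs ∈ xs
entry₁-∈ {_ ∷ _ ∷ []} refl = here refl

entry₂-∈ : ∀ {xs} → length xs ≡ 2 → entry₂ xs ∈ xs
entry₂-∈ {_ ∷ _ ∷ []} refl = there (here refl)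

entries-distinct : ∀ {xs} → length xs ≡ 2 → Unique xs → entry₁ xs ≢ entry₂ xs
entries-distinct {_ ∷ _ ∷ []} refl ((x≢y ∷ []) ∷ _) = x≢y

leafLists : ∀ {m} (M : Fin (suc m) → List ℕ) → IsKAssignment 2 M → LeafLists m
leafLists M two = record
  { first    = λ j → entry₁ (M (suc j))
  ; second   = λ j → entry₂ (M (suc j))
  ; distinct = λ j → entries-distinct (proj₁ (two (suc j))) (proj₂ (two (suc j)))
  }

⌈double/2⌉ : ∀ k → ⌈ k + k / 2 ⌉ ≡ k
⌈double/2⌉ k = begin
  (k + k + 1) / 2    ≡⟨ /-congˡ (solve 1 (λ k → k :+ k :+ con 1 := con 1 :+ k :* con 2) refl k) ⟩
  (1 + k * 2) / 2    ≡⟨ +-distrib-/-∣ʳ 1 {d = 2} (n∣m*n k {2}) ⟩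
  1 / 2 + k * 2 / 2  ≡⟨ cong (1 / 2 +_) (m*n/n≡m k 2) ⟩
  k                  ∎
  where open ≡-Reasoning

-- The star K_{1,m} ⊕ K_{1,m} with a 2-assignment L: the first star is
-- carried by Fin (suc m) ↑ˡ suc m, the second by suc m ↑ʳ Fin (suc m).
module TwoStars {m : ℕ} (L : Fin (suc m + suc m) → List ℕ) (two : IsKAssignment 2 L) where

  L₁ L₂ : Fin (suc m) → List ℕ
  L₁ i = L (i ↑ˡ suc m)
  L₂ i = L (suc m ↑ʳ i)

  ℓ₁ ℓ₂ : LeafLists m
  ℓ₁ = leafLists L₁ (λ i → two (i ↑ˡ suc m))
  ℓ₂ = leafLists L₂ (λ i → two (suc m ↑ʳ i))

  open Heaviness ℓ₁ ℓ₂ using (Heavy; heavy-from-stuck)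

  a b a' b' : ℕ
  a  = entry₁ (L₁ zero)
  b  = entry₂ (L₁ zero)
  a' = entry₁ (L₂ zero)
  b' = entry₂ (L₂ zero)

  a∈ : a ∈ L₁ zero
  a∈ = entry₁-∈ (proj₁ (two zero))
  b∈ : b ∈ L₁ zero
  b∈ = entry₂-∈ (proj₁ (two zero))
  a'∈ : a' ∈ L₂ zero
  a'∈ = entry₁-∈ (proj₁ (two (suc m ↑ʳ zero)))
  b'∈ : b' ∈ L₂ zero
  b'∈ = entry₂-∈ (proj₁ (two (suc m ↑ʳ zero)))

  a≢b : a ≢ b
  a≢b = entries-distinct (proj₁ (two zero)) (proj₂ (two zero))
  a'≢b' : a' ≢ b'
  a'≢b' = entries-distinct (proj₁ (two (suc m ↑ʳ zero))) (proj₂ (two (suc m ↑ʳ zero)))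

  unionOption : ℕ → ℕ → Fin (suc m) ⊎ Fin (suc m) → Bool → ℕ
  unionOption s t (inj₁ i) = starOption s ℓ₁ i
  unionOption s t (inj₂ i) = starOption t ℓ₂ i

  option : ℕ → ℕ → Fin (suc m + suc m) → Bool → ℕ
  option s t v = unionOption s t (splitAt (suc m) v)

  unionOption-proper : ∀ s t x y b b' → unionAdj (star m) (star m) x y →
                       unionOption s t x b ≢ unionOption s t y b'
  unionOption-proper s t (inj₁ i) (inj₁ j) b b' adj = starOption-proper s ℓ₁ i j b b' adj
  unionOption-proper s t (inj₂ i) (inj₂ j) b b' adj = starOption-proper t ℓ₂ i j b b' adj

  unionOption-∈ : ∀ {s t} → s ∈ L₁ zero → t ∈ L₂ zero →
                  ∀ x b → unionOption s t x b ∈ L (join (suc m) (suc m) x)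
  unionOption-∈ s∈ t∈ (inj₁ i) = starOption-∈ _ ℓ₁ L₁ s∈
    (λ j → entry₁-∈ (proj₁ (two (suc j ↑ˡ suc m)))) (λ j → entry₂-∈ (proj₁ (two (suc j ↑ˡ suc m)))) i
  unionOption-∈ s∈ t∈ (inj₂ i) = starOption-∈ _ ℓ₂ L₂ t∈
    (λ j → entry₁-∈ (proj₁ (two (suc m ↑ʳ suc j)))) (λ j → entry₂-∈ (proj₁ (two (suc m ↑ʳ suc j)))) i

  module WithCentres (s t : ℕ) where
    open Balancing (option s t) (suc m) ≤-refl public

    -- Stuck vertices are forced centres or forced leaves.
    stuck-bound : ∀ c → stuckCount c ≤ (𝟙 (s ≟ c) + pairCount ℓ₁ s c) + (𝟙 (t ≟ c) + pairCount ℓ₂ t c)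
    stuck-bound c = begin
      stuckCount c
        ≡⟨ sum-split (suc m) {suc m} isStuck ⟩
      sum (λ (i : Fin (suc m)) → isStuck (i ↑ˡ suc m)) + sum (λ i → isStuck (suc m ↑ʳ i))
        ≤⟨ +-mono-≤ (sum-mono λ i → 𝟙-mono (forced-left i) (stuck? c (i ↑ˡ suc m)) (starForced? s ℓ₁ c i))
                    (sum-mono λ i → 𝟙-mono (forced-right i) (stuck? c (suc m ↑ʳ i)) (starForced? t ℓ₂ c i)) ⟩
      sum (λ i → 𝟙 (starForced? s ℓ₁ c i)) + sum (λ i → 𝟙 (starForced? t ℓ₂ c i))
        ∎
      where
      open ≤-Reasoning
      isStuck : Fin (suc m + suc m) → ℕ
      isStuck v = 𝟙 (stuck? c v)
      forced-left : ∀ i → Stuck c (i ↑ˡ suc m) → StarForced s ℓ₁ c i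
      forced-left i (on-true , on-false) = starOption-stuck s ℓ₁ i
        (trans (cong (λ x → unionOption s t x true) (sym (Fin.splitAt-↑ˡ (suc m) i (suc m)))) on-true)
        (trans (cong (λ x → unionOption s t x false) (sym (Fin.splitAt-↑ˡ (suc m) i (suc m)))) on-false)
      forced-right : ∀ i → Stuck c (suc m ↑ʳ i) → StarForced t ℓ₂ c i
      forced-right i (on-true , on-false) = starOption-stuck t ℓ₂ i
        (trans (cong (λ x → unionOption s t x true) (sym (Fin.splitAt-↑ʳ (suc m) (suc m) i))) on-true)
        (trans (cong (λ x → unionOption s t x false) (sym (Fin.splitAt-↑ʳ (suc m) (suc m) i))) on-false)

    equitable : s ∈ L₁ zero → t ∈ L₂ zero → ∀ β → Balanced β →
                IsEquitableLColoring (star m ⊕ star m) 2 L (colouring β)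
    equitable s∈ t∈ β balanced = (proper , members) , within
      where
      proper : ∀ u v → Adj (star m ⊕ star m) u v → colouring β u ≢ colouring β v
      proper u v = unionOption-proper s t (splitAt (suc m) u) (splitAt (suc m) v) (β u) (β v)
      members : ∀ v → colouring β v ∈ L v
      members v = subst (λ w → colouring β v ∈ L w) (Fin.join-splitAt (suc m) (suc m) v)
                        (unionOption-∈ s∈ t∈ (splitAt (suc m) v) (β v))
      within : ∀ c → InPalette L c → colourCount (colouring β) c ≤ ⌈ suc m + suc m / 2 ⌉
      within c _ = begin
        colourCount (colouring β) c  ≡⟨ colourCount≡occurrences (colouring β) c ⟩
        count β c                    ≤⟨ balanced c ⟩
        suc m                        ≡⟨ ⌈double/2⌉ (suc m) ⟨
        ⌈ suc m + suc m / 2 ⌉        ∎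
        where open ≤-Reasoning

  attempt : 1 ≤ m → ∀ {s t} → s ∈ L₁ zero → t ∈ L₂ zero →
            Σ (Fin (suc m + suc m) → ℕ) (IsEquitableLColoring (star m ⊕ star m) 2 L) ⊎ ∃ (Heavy s t)
  attempt 1≤m {s} {t} s∈ t∈ with WithCentres.balance s t
  ... | inj₁ (β , balanced) = inj₁ (_ , WithCentres.equitable s t s∈ t∈ β balanced)
  ... | inj₂ (c , over) = inj₂ (c , heavy-from-stuck 1≤m (≤-trans over (WithCentres.stuck-bound s t c)))

-- Some choice of centre colours succeeds, since the four choices built
-- from the centre lists cannot all leave a heavy colour.
lemma3p6 : (m : ℕ) → 1 ≤ m → m ≤ 7 →
    EquitablyChoosable (star m ⊕ star m) 2
lemma3p6 m 1≤m m≤7 L two =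
  first-success (attempt 1≤m a∈ a'∈) (attempt 1≤m b∈ b'∈) (attempt 1≤m a∈ b'∈) (attempt 1≤m b∈ a'∈)
    (λ (_ , h₁) (_ , h₂) (_ , h₃) (_ , h₄) → not-all-heavy ℓ₁ ℓ₂ m≤7 a≢b a'≢b' h₁ h₂ h₃ h₄)
  where open TwoStars L two
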